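{- For every set $\Gamma\cup\{A\}$ of propositional formulas: $\Gamma\vdash_{i3g3}A$ if and only if $\Gamma\models_4A$.
   Context: Propositional language: propositional variables, $\bot$, ${\sim}$, $\land,\lor,\to$; $\neg A:=A\to\bot$, $A\leftrightarrow B:=(A\to B)\land(B\to A)$. $\vdash_{i3g3}$ is derivability in the Hilbert system with axioms $A\to(B\to A)$; $(A\to(B\to C))\to((A\to B)\to(A\to C))$; $(A\land B)\to A$; $(A\land B)\to B$; $(C\to A)\to((C\to B)\to(C\to(A\land B)))$; $A\to(A\lor B)$; $B\to(A\lor B)$; $(A\to C)\to((B\to C)\to((A\lor B)\to C))$; $\bot\to A$; $A\to{\sim}\bot$; ${\sim}{\sim}A\leftrightarrow A$; ${\sim}(A\land B)\leftrightarrow({\sim}A\lor{\sim}B)$; ${\sim}(A\lor B)\leftrightarrow({\sim}A\land{\sim}B)$; ${\sim}(A\to B)\leftrightarrow(\neg{\sim}A\land{\sim}B)$; ${\sim}A\to\neg A$; $\neg\neg(A\lor{\sim}A)$; $A\lor(A\to B)\lor\neg B$; and the rule MP. $\Gamma\vdash_{i3g3}A$ means a finite list ending in $A$ of members of $\Gamma$, axiom instances, or MP consequences of earlier items. Four-valued semantics with values $\mathbf 1,\mathbf i,\mathbf j,\mathbf 0$, linearly ordered $\mathbf 0<\mathbf j<\mathbf i<\mathbf 1$: $\bot$ has value $\mathbf 0$; $a\land b=\min(a,b)$, $a\lor b=\max(a,b)$; ${\sim}$: $\mathbf 1\mapsto\mathbf 0$, $\mathbf i\mapsto\mathbf j$,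 $\mathbf j\mapsto\mathbf i$, $\mathbf 0\mapsto\mathbf 1$; $\neg$: $\mathbf 1,\mathbf i\mapsto\mathbf 0$ and $\mathbf j,\mathbf 0\mapsto\mathbf 1$; $a\to b$: if $a\in\{\mathbf j,\mathbf 0\}$ then $\mathbf 1$; if $a=\mathbf 1$ then $b$; if $a=\mathbf i$ then $\mathbf 1$ for $b\in\{\mathbf 1,\mathbf i\}$ and $b$ for $b\in\{\mathbf j,\mathbf 0\}$. $\Gamma\models_4A$ iff every assignment of the four values to propositional variables, extended by these tables, that gives all $B\in\Gamma$ the value $\mathbf 1$ gives $A$ the value $\mathbf 1$. -}

module Defs where

open import Data.Nat using (ℕ)
open import Data.Product using (_×_; _,_)
open import Relation.Binary.PropositionalEquality using (_≡_)

infixr 5 _⇒_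
infixl 7 _∧_
infixl 6 _∨_

data Formula : Set where
  var  : ℕ → Formula
  ⊥'   : Formula
  ∼_   : Formula → Formula
  _∧_  : Formula → Formula → Formula
  _∨_  : Formula → Formula → Formula
  _⇒_  : Formula → Formula → Formula

¬' : Formula → Formula
¬' A = A ⇒ ⊥'

_⇔_ : Formula → Formula → Formula
A ⇔ B = (A ⇒ B) ∧ (B ⇒ A)

data Axiom : Formula → Set where
  ax1  : ∀ A B → Axiom (A ⇒ (B ⇒ A))
  ax2  : ∀ A B C → Axiom ((A ⇒ (B ⇒ C)) ⇒ ((A ⇒ B) ⇒ (A ⇒ C)))
  ax3  : ∀ A B → Axiom ((A ∧ B) ⇒ A)
  ax4  : ∀ A B → Axiom ((A ∧ B) ⇒ B)
  ax5  : ∀ A B C → Axiom ((C ⇒ A) ⇒ ((C ⇒ B) ⇒ (C ⇒ (A ∧ B))))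
  ax6  : ∀ A B → Axiom (A ⇒ (A ∨ B))
  ax7  : ∀ A B → Axiom (B ⇒ (A ∨ B))
  ax8  : ∀ A B C → Axiom ((A ⇒ C) ⇒ ((B ⇒ C) ⇒ ((A ∨ B) ⇒ C)))
  ax9  : ∀ A → Axiom (⊥' ⇒ A)
  ax10 : ∀ A → Axiom (A ⇒ ∼ ⊥')
  ax11 : ∀ A → Axiom ((∼ ∼ A) ⇔ A)
  ax12 : ∀ A B → Axiom ((∼ (A ∧ B)) ⇔ ((∼ A) ∨ (∼ B)))
  ax13 : ∀ A B → Axiom ((∼ (A ∨ B)) ⇔ ((∼ A) ∧ (∼ B)))
  ax14 : ∀ A B → Axiom ((∼ (A ⇒ B)) ⇔ ((¬' (∼ A)) ∧ (∼ B)))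
  ax15 : ∀ A → Axiom ((∼ A) ⇒ ¬' A)
  ax16 : ∀ A → Axiom (¬' (¬' (A ∨ (∼ A))))
  -- A ∨ (A → B) ∨ ¬B, with ∨ associating to the left (the two bracketings are
  -- interderivable)
  ax17 : ∀ A B → Axiom ((A ∨ (A ⇒ B)) ∨ ¬' B)

data _⊢_ (Γ : Formula → Set) : Formula → Set where
  hyp : ∀ {A} → Γ A → Γ ⊢ A
  ax  : ∀ {A} → Axiom A → Γ ⊢ A
  mp  : ∀ {A B} → Γ ⊢ (A ⇒ B) → Γ ⊢ A → Γ ⊢ B

-- Four truth values, ordered 0 < j < i < 1
data V4 : Set where
  𝟏 𝐢 𝐣 𝟎 : V4

min4 : V4 → V4 → V4
min4 𝟎 b = 𝟎
min4 𝐣 𝟎 = 𝟎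
min4 𝐣 b = 𝐣
min4 𝐢 𝟎 = 𝟎
min4 𝐢 𝐣 = 𝐣
min4 𝐢 b = 𝐢
min4 𝟏 b = b

max4 : V4 → V4 → V4
max4 𝟏 b = 𝟏
max4 𝐢 𝟏 = 𝟏
max4 𝐢 b = 𝐢
max4 𝐣 𝟏 = 𝟏
max4 𝐣 𝐢 = 𝐢
max4 𝐣 b = 𝐣
max4 𝟎 b = b

sneg4 : V4 → V4
sneg4 𝟏 = 𝟎
sneg4 𝐢 = 𝐣
sneg4 𝐣 = 𝐢
sneg4 𝟎 = 𝟏

imp4 : V4 → V4 → V4
imp4 𝐣 b = 𝟏
imp4 𝟎 b = 𝟏
imp4 𝟏 b = b
imp4 𝐢 𝟏 = 𝟏
imp4 𝐢 𝐢 = 𝟏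
imp4 𝐢 𝐣 = 𝐣
imp4 𝐢 𝟎 = 𝟎

-- (the table for ¬ follows from ¬A := A → ⊥ and imp4 with b = 𝟎)

eval : (ℕ → V4) → Formula → V4
eval v (var n) = v n
eval v ⊥' = 𝟎
eval v (∼ A) = sneg4 (eval v A)
eval v (A ∧ B) = min4 (eval v A) (eval v B)
eval v (A ∨ B) = max4 (eval v A) (eval v B)
eval v (A ⇒ B) = imp4 (eval v A) (eval v B)

_⊨₄_ : (Formula → Set) → Formula → Set
Γ ⊨₄ A = (v : ℕ → V4) → (∀ B → Γ B → eval v B ≡ 𝟏) → eval v A ≡ 𝟏

-- Soundness: every axiom is a tautology of the four-valued matrix (checked by evaluation) and
-- value 𝟏 is closed under modus ponens.
--
-- Completeness: if Γ ⊬ A, Lindenbaum's construction along an enumeration of formulas gives a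
-- deductively closed prime theory Δ ⊇ Γ with A ∉ Δ.  Every formula X is then either in Δ,
-- refuted (¬X ∈ Δ) or undecided, a value in the three-valued Gödel algebra G₃, which is the image of
-- the four-valued matrix under the homomorphism τ identifying 𝐣 with 𝟎.  The deduction theorem,
-- primeness and prelinearity A ∨ (A → B) ∨ ¬B make this assignment commute with ∧, ∨ and →.  The
-- strong negation is what separates 𝐣 from 𝟎: a variable p gets the value w determined by the G₃
-- values of p and ∼p, and the De Morgan axioms for ∼ carry the pair (τ w, τ ∼w) through all formulas.
-- So the canonical valuation gives exactly the members of Δ the value 𝟏.

module Submission where

open import Defs
open import Axiom.ExcludedMiddle using (ExcludedMiddle)
open import Level using (0ℓ)
open import Data.Empty using (⊥; ⊥-elim)
open import Data.Nat using (ℕ; zero; suc; _+_; _⊔_; _≤_; s≤s; _≤′_; ≤′-refl; ≤′-step)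
open import Data.Nat.Properties
  using (+-identityʳ; +-suc; ≤-refl; m+n≤o⇒m≤o; m+n≤o⇒n≤o; m≤m⊔n; m≤n⊔m; ≤⇒≤′)
open import Data.Product using (_×_; _,_; ∃; proj₁; proj₂)
open import Data.Sum using (_⊎_; inj₁; inj₂; [_,_])
open import Relation.Binary.PropositionalEquality
  using (_≡_; refl; sym; trans; cong; cong₂; subst; module ≡-Reasoning)
open import Relation.Nullary using (¬_; Dec; yes; no)
open import Relation.Nullary.Decidable using (True; toWitness; map′; _×-dec_; decidable-stable)
open import Relation.Unary using (_⊆_)

∀₄ : {P : V4 → Set} → P 𝟏 → P 𝐢 → P 𝐣 → P 𝟎 → ∀ a → P a
∀₄ p _ _ _ 𝟏 = p
∀₄ _ p _ _ 𝐢 = p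
∀₄ _ _ p _ 𝐣 = p
∀₄ _ _ _ p 𝟎 = p

∀₄? : {P : V4 → Set} → (∀ a → Dec (P a)) → Dec (∀ a → P a)
∀₄? P? = map′ (λ (p𝟏 , p𝐢 , p𝐣 , p𝟎) → ∀₄ p𝟏 p𝐢 p𝐣 p𝟎)
              (λ p → p 𝟏 , p 𝐢 , p 𝐣 , p 𝟎)
              (P? 𝟏 ×-dec P? 𝐢 ×-dec P? 𝐣 ×-dec P? 𝟎)

_≟𝟏 : ∀ a → Dec (a ≡ 𝟏)
𝟏 ≟𝟏 = yes refl
𝐢 ≟𝟏 = no λ ()
𝐣 ≟𝟏 = no λ ()
𝟎 ≟𝟏 = no λ ()

valuation₃ : V4 → V4 → V4 → ℕ → V4
valuation₃ a b c 0 = a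
valuation₃ a b c 1 = b
valuation₃ a b c _ = c

p q r : Formula
p = var 0
q = var 1
r = var 2

-- The Axiom argument only determines S; the implicit argument is discharged by evaluating S at all
-- 64 valuations of its variables p, q, r.
tautology₃ : ∀ {S} → Axiom S →
  {_ : True (∀₄? λ a → ∀₄? λ b → ∀₄? λ c → eval (valuation₃ a b c) S ≟𝟏)} →
  ∀ a b c → eval (valuation₃ a b c) S ≡ 𝟏
tautology₃ _ {check} = toWitness check

-- An instance evaluates under v exactly as the instance at p, q, r evaluates under valuation₃ of the
-- values of its parameters.
axiom-valid : ∀ {A} → Axiom A → ∀ v → eval v A ≡ 𝟏
axiom-valid (ax1 A B)   v = tautology₃ (ax1 p q)   (eval v A) (eval v B) 𝟏
axiom-valid (ax2 A B C) v = tautology₃ (ax2 p q r) (eval v A) (eval v B) (eval v C)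
axiom-valid (ax3 A B)   v = tautology₃ (ax3 p q)   (eval v A) (eval v B) 𝟏
axiom-valid (ax4 A B)   v = tautology₃ (ax4 p q)   (eval v A) (eval v B) 𝟏
axiom-valid (ax5 A B C) v = tautology₃ (ax5 p q r) (eval v A) (eval v B) (eval v C)
axiom-valid (ax6 A B)   v = tautology₃ (ax6 p q)   (eval v A) (eval v B) 𝟏
axiom-valid (ax7 A B)   v = tautology₃ (ax7 p q)   (eval v A) (eval v B) 𝟏
axiom-valid (ax8 A B C) v = tautology₃ (ax8 p q r) (eval v A) (eval v B) (eval v C)
axiom-valid (ax9 A)     v = tautology₃ (ax9 p)     (eval v A) 𝟏 𝟏
axiom-valid (ax10 A)    v = tautology₃ (ax10 p)    (eval v A) 𝟏 𝟏
axiom-valid (ax11 A)    v = tautology₃ (ax11 p)    (eval v A) 𝟏 𝟏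
axiom-valid (ax12 A B)  v = tautology₃ (ax12 p q)  (eval v A) (eval v B) 𝟏
axiom-valid (ax13 A B)  v = tautology₃ (ax13 p q)  (eval v A) (eval v B) 𝟏
axiom-valid (ax14 A B)  v = tautology₃ (ax14 p q)  (eval v A) (eval v B) 𝟏
axiom-valid (ax15 A)    v = tautology₃ (ax15 p)    (eval v A) 𝟏 𝟏
axiom-valid (ax16 A)    v = tautology₃ (ax16 p)    (eval v A) 𝟏 𝟏
axiom-valid (ax17 A B)  v = tautology₃ (ax17 p q)  (eval v A) (eval v B) 𝟏

imp4-𝟏 : ∀ {a b} → imp4 a b ≡ 𝟏 → a ≡ 𝟏 → b ≡ 𝟏
imp4-𝟏 a⇒b refl = a⇒b

sound : ∀ {Γ A} → Γ ⊢ A → Γ ⊨₄ A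
sound (hyp {A} ΓA) v ⊨Γ = ⊨Γ A ΓA
sound (ax a)       v ⊨Γ = axiom-valid a v
sound (mp d e)     v ⊨Γ = imp4-𝟏 (sound d v ⊨Γ) (sound e v ⊨Γ)

_,,_ : (Formula → Set) → Formula → (Formula → Set)
(Γ ,, B) X = Γ X ⊎ X ≡ B

weaken : ∀ {Γ Δ X} → Γ ⊆ Δ → Γ ⊢ X → Δ ⊢ X
weaken Γ⊆Δ (hyp ΓX) = hyp (Γ⊆Δ ΓX)
weaken Γ⊆Δ (ax a)   = ax a
weaken Γ⊆Δ (mp d e) = mp (weaken Γ⊆Δ d) (weaken Γ⊆Δ e)

wk₁ : ∀ {Γ B X} → Γ ⊢ X → (Γ ,, B) ⊢ X
wk₁ = weaken inj₁

assumption : ∀ {Γ B} → (Γ ,, B) ⊢ B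
assumption = hyp (inj₂ refl)

⇒-refl : ∀ {Γ} B → Γ ⊢ (B ⇒ B)
⇒-refl B = mp (mp (ax (ax2 B (B ⇒ B) B)) (ax (ax1 B (B ⇒ B)))) (ax (ax1 B B))

deduction : ∀ {Γ B C} → (Γ ,, B) ⊢ C → Γ ⊢ (B ⇒ C)
deduction {B = B} {C} (hyp (inj₁ ΓC))  = mp (ax (ax1 C B)) (hyp ΓC)
deduction {B = B}     (hyp (inj₂ refl)) = ⇒-refl B
deduction {B = B} {C} (ax a)           = mp (ax (ax1 C B)) (ax a)
deduction {B = B} {C} (mp {X} d e)     = mp (mp (ax (ax2 B X C)) (deduction d)) (deduction e)

∧-intro : ∀ {Γ X Y} → Γ ⊢ X → Γ ⊢ Y → Γ ⊢ (X ∧ Y)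
∧-intro {X = X} {Y} x y =
  mp (mp (mp (ax (ax5 X Y ⊤′)) (mp (ax (ax1 X ⊤′)) x)) (mp (ax (ax1 Y ⊤′)) y)) (⇒-refl ⊥')
  where
    ⊤′ : Formula
    ⊤′ = ⊥' ⇒ ⊥'

∧-elimˡ : ∀ {Γ X Y} → Γ ⊢ (X ∧ Y) → Γ ⊢ X
∧-elimˡ {X = X} {Y} = mp (ax (ax3 X Y))

∧-elimʳ : ∀ {Γ X Y} → Γ ⊢ (X ∧ Y) → Γ ⊢ Y
∧-elimʳ {X = X} {Y} = mp (ax (ax4 X Y))

∨-introˡ : ∀ {Γ X Y} → Γ ⊢ X → Γ ⊢ (X ∨ Y)
∨-introˡ {X = X} {Y} = mp (ax (ax6 X Y))

∨-introʳ : ∀ {Γ X Y} → Γ ⊢ Y → Γ ⊢ (X ∨ Y)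
∨-introʳ {X = X} {Y} = mp (ax (ax7 X Y))

∨-elim : ∀ {Γ X Y Z} → Γ ⊢ (X ∨ Y) → (Γ ,, X) ⊢ Z → (Γ ,, Y) ⊢ Z → Γ ⊢ Z
∨-elim {X = X} {Y} {Z} d dˡ dʳ = mp (mp (mp (ax (ax8 X Y Z)) (deduction dˡ)) (deduction dʳ)) d

⊥-elim′ : ∀ {Γ X} → Γ ⊢ ⊥' → Γ ⊢ X
⊥-elim′ {X = X} = mp (ax (ax9 X))

next : ℕ × ℕ → ℕ × ℕ
next (zero  , b) = suc b , 0
next (suc a , b) = a , suc b

-- unpair runs through the anti-diagonals a + b = d, each from (d , 0) down to (0 , d).
unpair : ℕ → ℕ × ℕ
unpair zero    = 0 , 0
unpair (suc n) = next (unpair n)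

unpair-surjective : ∀ a b → ∃ λ n → unpair n ≡ (a , b)
unpair-surjective a b = along-diagonal b a (diagonal-start (a + b))
  where
    Reached : ℕ × ℕ → Set
    Reached ab = ∃ λ n → unpair n ≡ ab

    along-diagonal : ∀ b a → Reached (a + b , 0) → Reached (a , b)
    along-diagonal zero    a h rewrite +-identityʳ a = h
    along-diagonal (suc b) a h with along-diagonal b (suc a) (subst (λ d → Reached (d , 0)) (+-suc a b) h)
    ... | n , eq = suc n , cong next eq

    diagonal-start : ∀ d → Reached (d , 0)
    diagonal-start zero = 0 , refl
    diagonal-start (suc d) with along-diagonal d 0 (diagonal-start d)
    ... | n , eq = suc n , cong next eq

-- decode fuel n: the fuel bounds the depth of the decoded formula; unpair n is a (tag , payload) pair.
mutual
  decode : ℕ → ℕ → Formula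
  decode zero    _ = ⊥'
  decode (suc f) n = decode-tagged f (unpair n)

  decode-tagged : ℕ → ℕ × ℕ → Formula
  decode-tagged f (0 , n) = var n
  decode-tagged f (1 , n) = ⊥'
  decode-tagged f (2 , n) = ∼ decode f n
  decode-tagged f (3 , n) = decode f (proj₁ (unpair n)) ∧ decode f (proj₂ (unpair n))
  decode-tagged f (4 , n) = decode f (proj₁ (unpair n)) ∨ decode f (proj₂ (unpair n))
  decode-tagged f (suc (suc (suc (suc (suc _)))) , n) =
    decode f (proj₁ (unpair n)) ⇒ decode f (proj₂ (unpair n))

HasCode : Formula → Set
HasCode X = ∃ λ n → ∃ λ f₀ → ∀ f → f₀ ≤ f → decode f n ≡ X

binary-HasCode : (_∙_ : Formula → Formula → Formula) (tag : ℕ) →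
  (∀ f n → decode-tagged f (tag , n) ≡ (decode f (proj₁ (unpair n)) ∙ decode f (proj₂ (unpair n)))) →
  ∀ {X Y} → HasCode X → HasCode Y → HasCode (X ∙ Y)
binary-HasCode _∙_ tag decode-tag {X} {Y} (m , f₁ , codeX) (n , f₂ , codeY)
  with unpair-surjective m n
... | mn , unpair-mn≡ with unpair-surjective tag mn
... | k , unpair-k≡ = k , suc (f₁ + f₂) , decodes
  where
    open ≡-Reasoning
    decodes : ∀ f → suc (f₁ + f₂) ≤ f → decode f k ≡ X ∙ Y
    decodes (suc f) (s≤s f₁+f₂≤f) = begin
      decode-tagged f (unpair k)
        ≡⟨ cong (decode-tagged f) unpair-k≡ ⟩
      decode-tagged f (tag , mn)
        ≡⟨ decode-tag f mn ⟩
      decode f (proj₁ (unpair mn)) ∙ decode f (proj₂ (unpair mn))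
        ≡⟨ cong (λ (i , j) → decode f i ∙ decode f j) unpair-mn≡ ⟩
      decode f m ∙ decode f n
        ≡⟨ cong₂ _∙_ (codeX f (m+n≤o⇒m≤o f₁ f₁+f₂≤f))
                     (codeY f (m+n≤o⇒n≤o f₁ f₁+f₂≤f)) ⟩
      X ∙ Y
        ∎

hasCode : ∀ X → HasCode X
hasCode (var n) with unpair-surjective 0 n
... | k , eq = k , 1 , λ { (suc f) _ → cong (decode-tagged f) eq }
hasCode ⊥' with unpair-surjective 1 0
... | k , eq = k , 1 , λ { (suc f) _ → cong (decode-tagged f) eq }
hasCode (∼ X) with hasCode X
... | n , f₀ , codeX with unpair-surjective 2 n
... | k , eq = k , suc f₀ , λ { (suc f) (s≤s f₀≤f) →
  trans (cong (decode-tagged f) eq) (cong ∼_ (codeX f f₀≤f)) }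
hasCode (X ∧ Y) = binary-HasCode _∧_ 3 (λ _ _ → refl) (hasCode X) (hasCode Y)
hasCode (X ∨ Y) = binary-HasCode _∨_ 4 (λ _ _ → refl) (hasCode X) (hasCode Y)
hasCode (X ⇒ Y) = binary-HasCode _⇒_ 5 (λ _ _ → refl) (hasCode X) (hasCode Y)

enumerate : ℕ → Formula
enumerate n = decode (proj₁ (unpair n)) (proj₂ (unpair n))

enumerate-surjective : ∀ X → ∃ λ n → enumerate n ≡ X
enumerate-surjective X with hasCode X
... | m , f₀ , codeX with unpair-surjective f₀ m
... | n , eq = n , trans (cong (λ (f , k) → decode f k) eq) (codeX f₀ ≤-refl)

record PrimeTheory (Δ : Formula → Set) : Set where
  field
    closed     : ∀ {X} → Δ ⊢ X → Δ X
    prime      : ∀ {X Y} → Δ (X ∨ Y) → Δ X ⊎ Δ Y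
    consistent : ¬ Δ ⊥'

module Lindenbaum (em : ExcludedMiddle 0ℓ) (Γ : Formula → Set) (A : Formula) (Γ⊬A : ¬ Γ ⊢ A) where

  stage : ℕ → Formula → Set
  stage zero      = Γ
  stage (suc n) X = stage n X ⊎ (X ≡ enumerate n × ¬ (stage n ,, enumerate n) ⊢ A)

  Δ : Formula → Set
  Δ X = ∃ λ n → stage n X

  stage-mono : ∀ {m n} → m ≤′ n → stage m ⊆ stage n
  stage-mono ≤′-refl        x = x
  stage-mono (≤′-step m≤′n) x = inj₁ (stage-mono m≤′n x)

  compact : ∀ {X} → Δ ⊢ X → ∃ λ n → stage n ⊢ X
  compact (hyp (n , x)) = n , hyp x
  compact (ax a)        = 0 , ax a
  compact (mp d e) with compact d | compact e
  ... | m , d′ | n , e′ = m ⊔ n , mp (weaken (stage-mono (≤⇒≤′ (m≤m⊔n m n))) d′)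
                                     (weaken (stage-mono (≤⇒≤′ (m≤n⊔m m n))) e′)

  -- A formula admitted at stage n + 1 comes with a proof that it does not yield A, so any derivation
  -- of A that uses it refutes that proof.
  stage⊬A : ∀ n → ¬ stage n ⊢ A
  stage⊬A zero    = Γ⊬A
  stage⊬A (suc n) d = stage⊬A n (weaken drop-last d)
    where
      d′ : (stage n ,, enumerate n) ⊢ A
      d′ = weaken (λ { (inj₁ x) → inj₁ x ; (inj₂ (refl , _)) → inj₂ refl }) d

      drop-last : stage (suc n) ⊆ stage n
      drop-last (inj₁ x)        = x
      drop-last (inj₂ (_ , ¬d)) = ⊥-elim (¬d d′)

  Δ⊬A : ¬ Δ ⊢ A
  Δ⊬A d with compact d
  ... | n , dₙ = stage⊬A n dₙ

  maximal : ∀ {X} → ¬ Δ X → (Δ ,, X) ⊢ A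
  maximal {X} X∉Δ with enumerate-surjective X
  ... | n , refl with em {(stage n ,, enumerate n) ⊢ A}
  ... | yes d  = weaken (λ { (inj₁ x) → inj₁ (n , x) ; (inj₂ eq) → inj₂ eq }) d
  ... | no ¬d  = ⊥-elim (X∉Δ (suc n , inj₂ (refl , ¬d)))

  Δ-prime : PrimeTheory Δ
  Δ-prime = record
    { closed     = λ d → decidable-stable em λ X∉Δ → Δ⊬A (mp (deduction (maximal X∉Δ)) d)
    ; prime      = λ X∨Y∈Δ → by-cases λ X∉Δ Y∉Δ →
                     Δ⊬A (∨-elim (hyp X∨Y∈Δ) (maximal X∉Δ) (maximal Y∉Δ))
    ; consistent = λ ⊥∈Δ → Δ⊬A (⊥-elim′ (hyp ⊥∈Δ))
    }
    where
      by-cases : ∀ {X Y} → (¬ Δ X → ¬ Δ Y → ⊥) → Δ X ⊎ Δ Y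
      by-cases {X} {Y} h with em {Δ X} | em {Δ Y}
      ... | yes x | _     = inj₁ x
      ... | no ¬x | yes y = inj₂ y
      ... | no ¬x | no ¬y = ⊥-elim (h ¬x ¬y)

lindenbaum : ExcludedMiddle 0ℓ → ∀ {Γ A} → ¬ Γ ⊢ A →
             ∃ λ Δ → PrimeTheory Δ × Γ ⊆ Δ × ¬ Δ A
lindenbaum em {Γ} {A} Γ⊬A = Δ , Δ-prime , (λ x → 0 , x) , (λ A∈Δ → Δ⊬A (hyp A∈Δ))
  where open Lindenbaum em Γ A Γ⊬A

data G₃ : Set where
  ⊤ᵍ ½ᵍ ⊥ᵍ : G₃

min₃ : G₃ → G₃ → G₃
min₃ ⊤ᵍ b  = b
min₃ ⊥ᵍ b  = ⊥ᵍ
min₃ ½ᵍ ⊤ᵍ = ½ᵍ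
min₃ ½ᵍ ½ᵍ = ½ᵍ
min₃ ½ᵍ ⊥ᵍ = ⊥ᵍ

max₃ : G₃ → G₃ → G₃
max₃ ⊤ᵍ b  = ⊤ᵍ
max₃ ⊥ᵍ b  = b
max₃ ½ᵍ ⊤ᵍ = ⊤ᵍ
max₃ ½ᵍ ½ᵍ = ½ᵍ
max₃ ½ᵍ ⊥ᵍ = ½ᵍ

imp₃ : G₃ → G₃ → G₃
imp₃ ⊥ᵍ b  = ⊤ᵍ
imp₃ ⊤ᵍ b  = b
imp₃ ½ᵍ ⊤ᵍ = ⊤ᵍ
imp₃ ½ᵍ ½ᵍ = ⊤ᵍ
imp₃ ½ᵍ ⊥ᵍ = ⊥ᵍ

τ : V4 → G₃
τ 𝟏 = ⊤ᵍ
τ 𝐢 = ½ᵍ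
τ 𝐣 = ⊥ᵍ
τ 𝟎 = ⊥ᵍ

τ-min : ∀ a b → τ (min4 a b) ≡ min₃ (τ a) (τ b)
τ-min
  = ∀₄ (∀₄ refl refl refl refl) (∀₄ refl refl refl refl)
       (∀₄ refl refl refl refl) (∀₄ refl refl refl refl)

τ-max : ∀ a b → τ (max4 a b) ≡ max₃ (τ a) (τ b)
τ-max
  = ∀₄ (∀₄ refl refl refl refl) (∀₄ refl refl refl refl)
       (∀₄ refl refl refl refl) (∀₄ refl refl refl refl)

τ-imp : ∀ a b → τ (imp4 a b) ≡ imp₃ (τ a) (τ b)
τ-imp
  = ∀₄ (∀₄ refl refl refl refl) (∀₄ refl refl refl refl)
       (∀₄ refl refl refl refl) (∀₄ refl refl refl refl)

τ-sneg-min : ∀ a b → τ (sneg4 (min4 a b)) ≡ max₃ (τ (sneg4 a)) (τ (sneg4 b))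
τ-sneg-min
  = ∀₄ (∀₄ refl refl refl refl) (∀₄ refl refl refl refl)
       (∀₄ refl refl refl refl) (∀₄ refl refl refl refl)

τ-sneg-max : ∀ a b → τ (sneg4 (max4 a b)) ≡ min₃ (τ (sneg4 a)) (τ (sneg4 b))
τ-sneg-max
  = ∀₄ (∀₄ refl refl refl refl) (∀₄ refl refl refl refl)
       (∀₄ refl refl refl refl) (∀₄ refl refl refl refl)

τ-sneg-imp : ∀ a b → τ (sneg4 (imp4 a b)) ≡ min₃ (imp₃ (τ (sneg4 a)) ⊥ᵍ) (τ (sneg4 b))
τ-sneg-imp
  = ∀₄ (∀₄ refl refl refl refl) (∀₄ refl refl refl refl)
       (∀₄ refl refl refl refl) (∀₄ refl refl refl refl)

sneg4-involutive : ∀ a → sneg4 (sneg4 a) ≡ a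
sneg4-involutive = ∀₄ refl refl refl refl

module CanonicalModel (em : ExcludedMiddle 0ℓ) {Δ : Formula → Set} (Δ-prime : PrimeTheory Δ) where
  open PrimeTheory Δ-prime

  data HasValue (X : Formula) : G₃ → Set where
    holds     : Δ X → HasValue X ⊤ᵍ
    refuted   : Δ (¬' X) → HasValue X ⊥ᵍ
    undecided : ¬ Δ X → ¬ Δ (¬' X) → HasValue X ½ᵍ

  non-contradictory : ∀ {X} → Δ X → Δ (¬' X) → ⊥
  non-contradictory x ¬x = consistent (closed (mp (hyp ¬x) (hyp x)))

  refute-by : ∀ {X Y} → Δ (¬' Y) → (Δ ,, X) ⊢ Y → Δ (¬' X)
  refute-by ¬y x⊢y = closed (deduction (mp (wk₁ (hyp ¬y)) x⊢y))

  refute-∨ : ∀ {X Y} → Δ (¬' X) → Δ (¬' Y) → Δ (¬' (X ∨ Y))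
  refute-∨ ¬x ¬y = closed (deduction
    (∨-elim assumption (mp (wk₁ (wk₁ (hyp ¬x))) assumption) (mp (wk₁ (wk₁ (hyp ¬y))) assumption)))

  ∼⇒¬ : ∀ {X} → Δ (∼ X) → Δ (¬' X)
  ∼⇒¬ {X} ∼x = closed (mp (ax (ax15 X)) (hyp ∼x))

  weak-excluded-middle : ∀ X → Δ (¬' X) ⊎ Δ (¬' (¬' X))
  weak-excluded-middle X with prime (closed (ax (ax17 (¬' X) X)))
  ... | inj₂ ¬x = inj₁ ¬x
  ... | inj₁ ¬x∨[¬x⇒x] with prime ¬x∨[¬x⇒x]
  ... | inj₁ ¬x   = inj₁ ¬x
  ... | inj₂ ¬x⇒x = inj₂ (closed (deduction (mp assumption (mp (wk₁ (hyp ¬x⇒x)) assumption))))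

  ¬¬-of-unrefuted : ∀ {X} → ¬ Δ (¬' X) → Δ (¬' (¬' X))
  ¬¬-of-unrefuted {X} ¬x∉Δ with weak-excluded-middle X
  ... | inj₁ ¬x  = ⊥-elim (¬x∉Δ ¬x)
  ... | inj₂ ¬¬x = ¬¬x

  unrefuted-∧ : ∀ {X Y} → ¬ Δ (¬' X) → ¬ Δ (¬' Y) → ¬ Δ (¬' (X ∧ Y))
  unrefuted-∧ {X} ¬x∉Δ ¬y∉Δ ¬x∧y = non-contradictory ¬x (¬¬-of-unrefuted ¬x∉Δ)
    where
      ¬x : Δ (¬' X)
      ¬x = refute-by (¬¬-of-unrefuted ¬y∉Δ)
             (deduction (mp (wk₁ (wk₁ (hyp ¬x∧y))) (∧-intro (wk₁ assumption) assumption)))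

  value : ∀ X → ∃ (HasValue X)
  value X with em {Δ X}
  ... | yes x = ⊤ᵍ , holds x
  ... | no x∉Δ with em {Δ (¬' X)}
  ... | yes ¬x   = ⊥ᵍ , refuted ¬x
  ... | no ¬x∉Δ = ½ᵍ , undecided x∉Δ ¬x∉Δ

  HasValue-⊥ : HasValue ⊥' ⊥ᵍ
  HasValue-⊥ = refuted (closed (⇒-refl ⊥'))

  HasValue-∧ : ∀ {X Y a b} → HasValue X a → HasValue Y b → HasValue (X ∧ Y) (min₃ a b)
  HasValue-∧ (holds x) (holds y) = holds (closed (∧-intro (hyp x) (hyp y)))
  HasValue-∧ (holds x) (undecided y∉Δ ¬y∉Δ) = undecided
    (λ x∧y → y∉Δ (closed (∧-elimʳ (hyp x∧y))))
    (λ ¬x∧y → ¬y∉Δ (refute-by ¬x∧y (∧-intro (wk₁ (hyp x)) assumption)))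
  HasValue-∧ (undecided x∉Δ ¬x∉Δ) (holds y) = undecided
    (λ x∧y → x∉Δ (closed (∧-elimˡ (hyp x∧y))))
    (λ ¬x∧y → ¬x∉Δ (refute-by ¬x∧y (∧-intro assumption (wk₁ (hyp y)))))
  HasValue-∧ (undecided x∉Δ ¬x∉Δ) (undecided _ ¬y∉Δ) = undecided
    (λ x∧y → x∉Δ (closed (∧-elimˡ (hyp x∧y))))
    (unrefuted-∧ ¬x∉Δ ¬y∉Δ)
  HasValue-∧ (holds _)       (refuted ¬y) = refuted (refute-by ¬y (∧-elimʳ assumption))
  HasValue-∧ (undecided _ _) (refuted ¬y) = refuted (refute-by ¬y (∧-elimʳ assumption))
  HasValue-∧ (refuted ¬x)    _            = refuted (refute-by ¬x (∧-elimˡ assumption))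

  HasValue-∨ : ∀ {X Y a b} → HasValue X a → HasValue Y b → HasValue (X ∨ Y) (max₃ a b)
  HasValue-∨ (holds x)       _            = holds (closed (∨-introˡ (hyp x)))
  HasValue-∨ (undecided _ _) (holds y)    = holds (closed (∨-introʳ (hyp y)))
  HasValue-∨ (refuted _)     (holds y)    = holds (closed (∨-introʳ (hyp y)))
  HasValue-∨ (refuted ¬x)    (refuted ¬y) = refuted (refute-∨ ¬x ¬y)
  HasValue-∨ (refuted ¬x) (undecided y∉Δ ¬y∉Δ) = undecided
    (λ x∨y → [ (λ x → non-contradictory x ¬x) , y∉Δ ] (prime x∨y))
    (λ ¬x∨y → ¬y∉Δ (refute-by ¬x∨y (∨-introʳ assumption)))
  HasValue-∨ (undecided x∉Δ ¬x∉Δ) (refuted ¬y) = undecided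
    (λ x∨y → [ x∉Δ , (λ y → non-contradictory y ¬y) ] (prime x∨y))
    (λ ¬x∨y → ¬x∉Δ (refute-by ¬x∨y (∨-introˡ assumption)))
  HasValue-∨ (undecided x∉Δ ¬x∉Δ) (undecided y∉Δ _) = undecided
    (λ x∨y → [ x∉Δ , y∉Δ ] (prime x∨y))
    (λ ¬x∨y → ¬x∉Δ (refute-by ¬x∨y (∨-introˡ assumption)))

  HasValue-⇒ : ∀ {X Y a b} → HasValue X a → HasValue Y b → HasValue (X ⇒ Y) (imp₃ a b)
  HasValue-⇒ (refuted ¬x)    _         = holds (closed (deduction (⊥-elim′ (mp (wk₁ (hyp ¬x)) assumption))))
  HasValue-⇒ (holds _)       (holds y) = holds (closed (deduction (wk₁ (hyp y))))
  HasValue-⇒ (undecided _ _) (holds y) = holds (closed (deduction (wk₁ (hyp y))))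
  HasValue-⇒ (holds x) (refuted ¬y) = refuted (refute-by ¬y (mp assumption (wk₁ (hyp x))))
  HasValue-⇒ (holds x) (undecided y∉Δ ¬y∉Δ) = undecided
    (λ x⇒y → y∉Δ (closed (mp (hyp x⇒y) (hyp x))))
    (λ ¬[x⇒y] → ¬y∉Δ (refute-by ¬[x⇒y] (deduction (wk₁ assumption))))
  -- By prelinearity X ∨ (X ⇒ Y) ∨ ¬Y: neither X nor ¬Y is in Δ, so X ⇒ Y is.
  HasValue-⇒ {X} {Y} (undecided x∉Δ _) (undecided _ ¬y∉Δ) with prime (closed (ax (ax17 X Y)))
  ... | inj₂ ¬y = ⊥-elim (¬y∉Δ ¬y)
  ... | inj₁ x∨[x⇒y] with prime x∨[x⇒y]
  ... | inj₁ x   = ⊥-elim (x∉Δ x)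
  ... | inj₂ x⇒y = holds x⇒y
  HasValue-⇒ (undecided _ ¬x∉Δ) (refuted ¬y) = refuted
    (refute-by (¬¬-of-unrefuted ¬x∉Δ)
      (deduction (mp (wk₁ (wk₁ (hyp ¬y))) (mp (wk₁ assumption) assumption))))

  HasValue-resp-⇔ : ∀ {X Y a} → Axiom (Y ⇔ X) → HasValue X a → HasValue Y a
  HasValue-resp-⇔ Y⇔X (holds x)    = holds (closed (mp (∧-elimʳ (ax Y⇔X)) (hyp x)))
  HasValue-resp-⇔ Y⇔X (refuted ¬x) = refuted (refute-by ¬x (mp (∧-elimˡ (ax Y⇔X)) assumption))
  HasValue-resp-⇔ Y⇔X (undecided x∉Δ ¬x∉Δ) = undecided
    (λ y → x∉Δ (closed (mp (∧-elimˡ (ax Y⇔X)) (hyp y))))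
    (λ ¬y → ¬x∉Δ (refute-by ¬y (mp (∧-elimʳ (ax Y⇔X)) assumption)))

  -- The pair (τ w , τ (sneg4 w)) determines w; the five pairs that no w realises are refuted by
  -- ∼X ⇒ ¬X and ¬¬(X ∨ ∼X).
  realise : ∀ {X g h} → HasValue X g → HasValue (∼ X) h →
            ∃ λ w → τ w ≡ g × τ (sneg4 w) ≡ h
  realise (holds _)       (refuted _)     = 𝟏 , refl , refl
  realise (undecided _ _) (refuted _)     = 𝐢 , refl , refl
  realise (refuted _)     (undecided _ _) = 𝐣 , refl , refl
  realise (refuted _)     (holds _)       = 𝟎 , refl , refl
  realise (holds x)          (holds ∼x) = ⊥-elim (non-contradictory x (∼⇒¬ ∼x))
  realise (undecided _ ¬x∉Δ) (holds ∼x) = ⊥-elim (¬x∉Δ (∼⇒¬ ∼x))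
  realise {X} (holds x) (undecided _ ¬∼x∉Δ) =
    ⊥-elim (¬∼x∉Δ (closed (deduction (mp (mp (ax (ax15 X)) assumption) (wk₁ (hyp x))))))
  realise {X} (undecided _ ¬x∉Δ) (undecided _ ¬∼x∉Δ) = ⊥-elim (unrefuted-∧ ¬x∉Δ ¬∼x∉Δ
    (closed (deduction (mp (mp (ax (ax15 X)) (∧-elimʳ assumption)) (∧-elimˡ assumption)))))
  realise {X} (refuted ¬x) (refuted ¬∼x) =
    ⊥-elim (non-contradictory (refute-∨ ¬x ¬∼x) (closed (ax (ax16 X))))

  realise-var : ∀ n →
    ∃ λ w → τ w ≡ proj₁ (value (var n)) × τ (sneg4 w) ≡ proj₁ (value (∼ var n))
  realise-var n = realise (proj₂ (value (var n))) (proj₂ (value (∼ var n)))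

  valuation : ℕ → V4
  valuation n = proj₁ (realise-var n)

  ⟦_⟧ : Formula → V4
  ⟦ B ⟧ = eval valuation B

  via-τ : ∀ {X a g} → τ a ≡ g → HasValue X g → HasValue X (τ a)
  via-τ {X} τa≡g = subst (HasValue X) (sym τa≡g)

  truth : ∀ B → HasValue B (τ ⟦ B ⟧) × HasValue (∼ B) (τ (sneg4 ⟦ B ⟧))
  truth (var n) = via-τ (proj₁ (proj₂ (realise-var n))) (proj₂ (value (var n)))
                , via-τ (proj₂ (proj₂ (realise-var n))) (proj₂ (value (∼ var n)))
  truth ⊥'      = HasValue-⊥ , holds (closed (mp (ax (ax10 (⊥' ⇒ ⊥'))) (⇒-refl ⊥')))
  truth (∼ B) with truth B
  ... | B⁺ , B⁻ = B⁻ , via-τ (cong τ (sneg4-involutive ⟦ B ⟧)) (HasValue-resp-⇔ (ax11 B) B⁺)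
  truth (B ∧ C) with truth B | truth C
  ... | B⁺ , B⁻ | C⁺ , C⁻ =
      via-τ (τ-min ⟦ B ⟧ ⟦ C ⟧) (HasValue-∧ B⁺ C⁺)
    , via-τ (τ-sneg-min ⟦ B ⟧ ⟦ C ⟧) (HasValue-resp-⇔ (ax12 B C) (HasValue-∨ B⁻ C⁻))
  truth (B ∨ C) with truth B | truth C
  ... | B⁺ , B⁻ | C⁺ , C⁻ =
      via-τ (τ-max ⟦ B ⟧ ⟦ C ⟧) (HasValue-∨ B⁺ C⁺)
    , via-τ (τ-sneg-max ⟦ B ⟧ ⟦ C ⟧) (HasValue-resp-⇔ (ax13 B C) (HasValue-∧ B⁻ C⁻))
  truth (B ⇒ C) with truth B | truth C
  ... | B⁺ , B⁻ | C⁺ , C⁻ =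
      via-τ (τ-imp ⟦ B ⟧ ⟦ C ⟧) (HasValue-⇒ B⁺ C⁺)
    , via-τ (τ-sneg-imp ⟦ B ⟧ ⟦ C ⟧)
        (HasValue-resp-⇔ (ax14 B C) (HasValue-∧ (HasValue-⇒ B⁻ HasValue-⊥) C⁻))

  ∈⇒𝟏 : ∀ {B} → Δ B → ⟦ B ⟧ ≡ 𝟏
  ∈⇒𝟏 {B} B∈Δ = HasValue-τ⇒𝟏 ⟦ B ⟧ (proj₁ (truth B))
    where
      HasValue-τ⇒𝟏 : ∀ a → HasValue B (τ a) → a ≡ 𝟏
      HasValue-τ⇒𝟏 𝟏 _                 = refl
      HasValue-τ⇒𝟏 𝐢 (undecided B∉Δ _) = ⊥-elim (B∉Δ B∈Δ)
      HasValue-τ⇒𝟏 𝐣 (refuted ¬B)      = ⊥-elim (non-contradictory B∈Δ ¬B)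
      HasValue-τ⇒𝟏 𝟎 (refuted ¬B)      = ⊥-elim (non-contradictory B∈Δ ¬B)

  𝟏⇒∈ : ∀ {B} → ⟦ B ⟧ ≡ 𝟏 → Δ B
  𝟏⇒∈ {B} B≡𝟏 with subst (HasValue B) (cong τ B≡𝟏) (proj₁ (truth B))
  ... | holds B∈Δ = B∈Δ

complete : ExcludedMiddle 0ℓ → ∀ {Γ A} → Γ ⊨₄ A → Γ ⊢ A
complete em {Γ} {A} Γ⊨A with em {Γ ⊢ A}
... | yes Γ⊢A = Γ⊢A
... | no Γ⊬A with lindenbaum em Γ⊬A
... | Δ , Δ-prime , Γ⊆Δ , A∉Δ =
  ⊥-elim (A∉Δ (𝟏⇒∈ (Γ⊨A valuation (λ _ B∈Γ → ∈⇒𝟏 (Γ⊆Δ B∈Γ)))))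
  where open CanonicalModel em Δ-prime

corollary4p4 : ExcludedMiddle 0ℓ → (Γ : Formula → Set) (A : Formula) →
    ((Γ ⊢ A → Γ ⊨₄ A) × (Γ ⊨₄ A → Γ ⊢ A))
corollary4p4 em Γ A = sound , complete em
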